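{- Let $\ast$ be a uniformity preserving operation on a finite set $\mathcal{X}$. Then: (1) If $\ast$ is strongly ergodic then it is ergodic. (2) If $\ast$ is strongly ergodic, there exists an integer $d>0$ such that for every $s\geq d$, every stable partition $\mathcal{H}$ of $(\mathcal{X},\ast)$, every $x\in\mathcal{X}$ and every $H\in\mathcal{H}^{s\ast}$, there exists an $\mathcal{H}$-sequence $\mathfrak{X}$ of length $s$ with $x\ast\mathfrak{X}=H$. (3) If $\ast$ is ergodic, then $\ast$ is strongly ergodic if and only if $\mathcal{K}_{\mathcal{H}}=\mathcal{H}$ for every stable partition $\mathcal{H}$ of $(\mathcal{X},\ast)$. (4) If $\ast$ is a quasigroup operation, then it is strongly ergodic.
   Context: A binary operation $\ast$ on finite $\mathcal{X}$ is uniformity preserving if for every $b$ the map $x\mapsto x\ast b$ is bijective; it is a quasigroup operation if moreover for every $b$ the map $x\mapsto b\ast x$ is bijective. For $A,B\subset\mathcal{X}$, $A\ast B=\{a\ast b:a\in A,b\in B\}$. $a$ is $\ast$-connectable to $b$ in $l$ steps if there exist $x_0,\dots,x_{l-1}$ with $(\cdots((a\ast x_0)\ast x_1)\cdots)\ast x_{l-1}=b$; a uniformity preserving $\ast$ is ergodic if for some $l>0$ every element is connectable to every element in $l$ steps. For a set $\mathcal{H}$ of subsets, $\mathcal{H}^{\ast}=\{A\ast B:A,B\in\mathcal{H}\}$, $\mathcal{H}^{0\ast}=\mathcal{H}$, $\mathcal{H}^{n\ast}=(\mathcal{H}^{(n-1)\ast})^{\ast}$. A partition $\mathcal{H}$ is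 periodic if $\mathcal{H}^{n\ast}=\mathcal{H}$ for some $n>0$ (least such $n$: $\mathrm{per}(\mathcal{H})$), balanced if all blocks have equal size, stable if balanced and periodic. For a sequence $\mathfrak{X}=(X_0,\dots,X_{k-1})$ of subsets, $|\mathfrak{X}|=k$, $A\ast\mathfrak{X}=(\cdots((A\ast X_0)\ast X_1)\cdots)\ast X_{k-1}$, $x\ast\mathfrak{X}=\{x\}\ast\mathfrak{X}$. $\mathfrak{X}$ is an $\mathcal{H}$-sequence if $X_i\in\mathcal{H}^{i\ast}$ for all $i$; $\mathcal{H}$-repeatable if also $\mathrm{per}(\mathcal{H})\mid k$; $\mathcal{H}$-augmenting if $\mathcal{H}$-repeatable and $A\subset A\ast\mathfrak{X}$ for all $A\subset\mathcal{X}$. The operation $\ast$ is strongly ergodic if for every stable partition $\mathcal{H}$ and every $x\in\mathcal{X}$ there is an integer $n=n(x,\mathcal{H})$ such that for every $H\in\mathcal{H}^{n\ast}$ there exists an $\mathcal{H}$-sequence $\mathfrak{X}$ of length $n$ with $x\ast\mathfrak{X}=H$. For a stable partition $\mathcal{H}$, define the relation $aR_{\mathcal{H}}b$ iff there exists an $\mathcal{H}$-augmenting sequence $\mathfrak{X}$ with $\{a,b\}\subset a\ast\mathfrak{X}$ and $\{a,b\}\subset b\ast\mathfrak{X}$; this is an equivalence relation, and $\mathcal{K}_{\mathcal{H}}$ (the first residue of $\mathcal{H}$) denotes its set of equivalence classes. -}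

module Defs where

open import Data.Nat using (ℕ; zero; suc; _<_; _>_)
open import Data.Nat.Divisibility using (_∣_)
open import Data.Fin using (Fin; zero; suc; _≟_)
open import Data.Fin.Subset using (Subset; _∈_; _⊆_; ⁅_⁆; ∣_∣; _∩_; Nonempty; Empty)
open import Data.Bool using (Bool; true; false; _∧_; _∨_)
open import Data.Vec using (Vec; []; _∷_; tabulate; lookup; foldl)
open import Data.List using (List; []; _∷_; length)
open import Data.Product using (Σ; ∃; ∃-syntax; _×_; _,_)
open import Data.Sum using (_⊎_)
open import Relation.Nullary using (¬_)
open import Data.Unit using (⊤)
open import Relation.Nullary.Decidable using (⌊_⌋)
open import Relation.Binary.PropositionalEquality using (_≡_)
open import Function.Definitions using (Bijective)

anyFin : ∀ {k} → (Fin k → Bool) → Bool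
anyFin {zero}  f = false
anyFin {suc k} f = f zero ∨ anyFin (λ i → f (suc i))

Fam : ℕ → Set₁
Fam n = Subset n → Set

_≐_ : ∀ {n} → Fam n → Fam n → Set
F ≐ G = ∀ C → (F C → G C) × (G C → F C)

IsPartition : ∀ {n} → Fam n → Set
IsPartition {n} H =
  (∀ A → H A → Nonempty A) ×
  (∀ A B → H A → H B → A ≡ B ⊎ Empty (A ∩ B)) ×
  (∀ (x : Fin n) → ∃[ A ] (H A × x ∈ A))

IsBalanced : ∀ {n} → Fam n → Set
IsBalanced H = ∀ A B → H A → H B → ∣ A ∣ ≡ ∣ B ∣

module _ {n : ℕ} (_∙_ : Fin n → Fin n → Fin n) where

  UniformityPreserving : Set
  UniformityPreserving = ∀ b → Bijective _≡_ _≡_ (λ x → x ∙ b)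

  IsQuasigroupOp : Set
  IsQuasigroupOp = UniformityPreserving × (∀ b → Bijective _≡_ _≡_ (λ x → b ∙ x))

  -- A ∗ B = { a ∙ b : a ∈ A, b ∈ B }
  _⊛_ : Subset n → Subset n → Subset n
  A ⊛ B = tabulate λ c → anyFin λ a → anyFin λ b →
            lookup A a ∧ lookup B b ∧ ⌊ (a ∙ b) ≟ c ⌋

  Ergodic : Set
  Ergodic = ∃[ l ] (l > 0 × (∀ a b → Σ (Vec (Fin n) l) (λ xs → foldl (λ _ → Fin n) _∙_ a xs ≡ b)))

  star : Fam n → Fam n
  star F C = ∃[ A ] ∃[ B ] (F A × F B × C ≡ A ⊛ B)

  Pow : ℕ → Fam n → Fam n
  Pow zero    H = H
  Pow (suc k) H = star (Pow k H)

  IsPer : Fam n → ℕ → Set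
  IsPer H p = p > 0 × (Pow p H ≐ H) × (∀ m → m > 0 → m < p → ¬ (Pow m H ≐ H))

  Periodic : Fam n → Set
  Periodic H = ∃[ p ] (p > 0 × (Pow p H ≐ H))

  Stable : Fam n → Set
  Stable H = IsPartition H × IsBalanced H × Periodic H

  applySeq : Subset n → List (Subset n) → Subset n
  applySeq A []       = A
  applySeq A (X ∷ Xs) = applySeq (A ⊛ X) Xs

  -- X_i ∈ ℋ^{(i+j)∗} for the i-th entry (j = offset; ℋ-sequence is offset 0)
  SeqFrom : Fam n → ℕ → List (Subset n) → Set
  SeqFrom H j []       = ⊤
  SeqFrom H j (X ∷ Xs) = Pow j H X × SeqFrom H (suc j) Xs

  IsHSeq : Fam n → List (Subset n) → Set
  IsHSeq H Xs = SeqFrom H 0 Xs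

  Repeatable : Fam n → List (Subset n) → Set
  Repeatable H Xs = IsHSeq H Xs × ∃[ p ] (IsPer H p × p ∣ length Xs)

  Augmenting : Fam n → List (Subset n) → Set
  Augmenting H Xs = Repeatable H Xs × (∀ A → A ⊆ applySeq A Xs)

  R : Fam n → Fin n → Fin n → Set
  R H a b = ∃[ Xs ] (Augmenting H Xs ×
              (a ∈ applySeq ⁅ a ⁆ Xs × b ∈ applySeq ⁅ a ⁆ Xs) ×
              (a ∈ applySeq ⁅ b ⁆ Xs × b ∈ applySeq ⁅ b ⁆ Xs))

  K : Fam n → Fam n
  K H C = ∃[ a ] (∀ y → (y ∈ C → R H a y) × (R H a y → y ∈ C))

  StronglyErgodic : Set₁
  StronglyErgodic = ∀ H → Stable H → ∀ x → ∃[ m ] (∀ G → Pow m H G →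
      ∃[ Xs ] (IsHSeq H Xs × length Xs ≡ m × applySeq ⁅ x ⁆ Xs ≡ G))

-- Fix a stable partition ℋ with period q and call an ℋ-sequence cyclic when q divides its length;
-- a cyclic sequence maps each block of ℋ onto a block of ℋ.  The argument is organised around the
-- property that x returns: some cyclic sequence carries {x} onto the block of x.
-- If x reaches every member of ℋ^{m∗}, then x returns (reach a block through a preimage of x and pad
-- the length to a multiple of q); conversely, if ∗ connects any two points in l steps, a return of x
-- followed by a walk of length q·l reaches every block.  All points return iff 𝒦_ℋ = ℋ: a cyclic
-- sequence carrying a and b onto their block, repeated until the induced permutation x ↦ x ∗ 𝔛 is the
-- identity, is augmenting and witnesses a R_ℋ b; conversely the augmenting witnesses of a R_ℋ b, for
-- b in the block of a, concatenate to a return of a.  For a quasigroup, counting with balanced blocks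
-- gives {x} ∗ Y = B ∗ Y for x ∈ B ∈ ℋ and Y ∈ ℋ, hence returns.
-- Ergodicity is strong ergodicity for the one-block partition {𝒳}.  For the uniform bound, the members
-- of each ℋ^{j∗} are rigid (A ∗ Y = A ∗ {y} for y ∈ Y), so the length of any identity word is a period
-- of every stable partition; stability then becomes decidable on finitely many codes.

module Submission where

open import Defs
open import Data.Bool as Bool using (Bool; true; false; _∧_)
open import Data.Bool.Properties using (T-≡)
open import Data.Empty using (⊥-elim)
open import Data.Fin using (Fin; zero; suc; _≟_; toℕ)
import Data.Fin.Properties as Finₚ
open import Data.Fin.Subset using (Subset; _∈_; _∉_; _⊆_; ⁅_⁆; ∣_∣; _∩_; Nonempty; Empty; ⊤; _-_; inside; outside)
import Data.Fin.Subset.Properties as Subsetₚ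
open import Data.List using (List; []; _∷_; length; _++_; [_]; concat; replicate; foldl; map)
import Data.List.Properties as Listₚ
open import Data.List.Relation.Binary.Pointwise as Pointwise using (Pointwise; []; _∷_)
open import Data.Nat as ℕ using (ℕ; zero; suc; _+_; _*_; _≤_; _<_; _>_; _≥_; z≤n; s≤s; _⊔_; _∸_; _≤′_; ≤′-refl; ≤′-step)
import Data.Nat.Properties as ℕₚ
open import Data.Nat.Divisibility using (_∣_; divides; ∣m∣n⇒∣m+n; n∣m*n; m∣m*n; ∣-refl)
open import Data.Nat.GeneralisedArithmetic using (iterate)
open import Data.Product using (Σ; ∃-syntax; _×_; _,_; proj₁; proj₂)
open import Data.Sum using (_⊎_; inj₁; inj₂)
open import Data.Unit using (tt)
open import Data.Vec as Vec using (Vec; []; _∷_; tabulate; lookup; here; there)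
import Data.Vec.Properties as Vecₚ
open import Function.Base using (_∘_; id)
open import Function.Bundles using (_⇔_; mk⇔; Equivalence)
open import Function.Definitions using (Injective)
open import Relation.Binary.PropositionalEquality hiding ([_])
open import Relation.Nullary using (¬_; Dec; yes; no)
open import Relation.Nullary.Decidable using (⌊_⌋; toWitness; fromWitness; decidable-stable; _×-dec_; _⊎-dec_; _→-dec_; ¬?)
open import Relation.Unary using (Decidable)

-- Finite sets

module _ {A : Set} (f : A → A) where

  iterate-+ : ∀ x a b → iterate f x (a + b) ≡ iterate f (iterate f x a) b
  iterate-+ x zero    b = refl
  iterate-+ x (suc a) b = iterate-+ (f x) a b

  iterate-multiple : ∀ {x d} → iterate f x d ≡ x → ∀ t → iterate f x (t * d) ≡ x
  iterate-multiple         fix zero    = refl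
  iterate-multiple {x} {d} fix (suc t) = begin
    iterate f x (d + t * d)           ≡⟨ iterate-+ x d (t * d) ⟩
    iterate f (iterate f x d) (t * d) ≡⟨ cong (λ y → iterate f y (t * d)) fix ⟩
    iterate f x (t * d)               ≡⟨ iterate-multiple fix t ⟩
    x                                 ∎
    where open ≡-Reasoning

  iterate-injective : Injective _≡_ _≡_ f → ∀ k → Injective _≡_ _≡_ (λ x → iterate f x k)
  iterate-injective inj zero    eq = eq
  iterate-injective inj (suc k) eq = inj (iterate-injective inj k eq)

module _ {n} (f : Fin n → Fin n) (inj : Injective _≡_ _≡_ f) where

  orbit-periodic : ∀ x → ∃[ d ] (d > 0 × iterate f x d ≡ x)
  orbit-periodic x with Finₚ.pigeonhole (ℕₚ.n<1+n n) (λ i → iterate f x (toℕ i))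
  ... | i , j , i<j , eq = toℕ j ∸ toℕ i , ℕₚ.m<n⇒0<n∸m i<j ,
    sym (iterate-injective f inj (toℕ i) (begin
      iterate f x (toℕ i)                             ≡⟨ eq ⟩
      iterate f x (toℕ j)                             ≡⟨ cong (iterate f x) (ℕₚ.m∸n+n≡m (ℕₚ.<⇒≤ i<j)) ⟨
      iterate f x (toℕ j ∸ toℕ i + toℕ i)             ≡⟨ iterate-+ f x (toℕ j ∸ toℕ i) (toℕ i) ⟩
      iterate f (iterate f x (toℕ j ∸ toℕ i)) (toℕ i) ∎))
    where open ≡-Reasoning

  common-period : ∀ {k} (xs : Fin k → Fin n) → ∃[ N ] (N > 0 × ∀ i → iterate f (xs i) N ≡ xs i)
  common-period {zero}  xs = 1 , s≤s z≤n , λ ()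
  common-period {suc k} xs with orbit-periodic (xs zero) | common-period (xs ∘ suc)
  ... | d , d>0 , fix | N , N>0 , fixes = N * d , ℕₚ.*-mono-< N>0 d>0 , returns
    where
    returns : ∀ i → iterate f (xs i) (N * d) ≡ xs i
    returns zero    = iterate-multiple f fix N
    returns (suc i) = subst (λ m → iterate f (xs (suc i)) m ≡ xs (suc i)) (ℕₚ.*-comm d N)
                        (iterate-multiple f (fixes i) d)

  injective⇒periodic : ∃[ N ] (N > 0 × ∀ x → iterate f x N ≡ x)
  injective⇒periodic = common-period id

least-witness : ∀ {P : ℕ → Set} → Decidable P → ∀ {k} → P k → ∃[ m ] (P m × ∀ {i} → i < m → ¬ P i)
least-witness P? {zero}  p = zero , p , λ ()
least-witness P? {suc k} p with P? zero
... | yes p₀ = zero , p₀ , λ ()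
... | no ¬p₀ with least-witness (P? ∘ suc) p
...   | m , pm , below = suc m , pm , λ { {zero} _ → ¬p₀ ; {suc i} (s≤s i<m) → below i<m }

BoundedAbove : Set → Set
BoundedAbove A = (f : A → ℕ) → ∃[ b ] (∀ x → f x ≤ b)

Fin-boundedAbove : ∀ k → BoundedAbove (Fin k)
Fin-boundedAbove zero    f = 0 , λ ()
Fin-boundedAbove (suc k) f with Fin-boundedAbove k (f ∘ suc)
... | b , bound = f zero ⊔ b , λ { zero → ℕₚ.m≤m⊔n _ _ ; (suc i) → ℕₚ.m≤n⇒m≤o⊔n (f zero) (bound i) }

Bool-boundedAbove : BoundedAbove Bool
Bool-boundedAbove f = f true ⊔ f false , λ { true → ℕₚ.m≤m⊔n _ _ ; false → ℕₚ.m≤n⊔m _ _ }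

Vec-boundedAbove : ∀ {A} → BoundedAbove A → ∀ k → BoundedAbove (Vec A k)
Vec-boundedAbove bA zero    f = f [] , λ { [] → ℕₚ.≤-refl }
Vec-boundedAbove bA (suc k) f with bA (λ a → proj₁ (Vec-boundedAbove bA k (f ∘ (a ∷_))))
... | b , bound = b , λ { (a ∷ v) → ℕₚ.≤-trans (proj₂ (Vec-boundedAbove bA k (f ∘ (a ∷_))) v) (bound a) }

∣p∣≡1+∣p-x∣ : ∀ {n} {p : Subset n} {x} → x ∈ p → ∣ p ∣ ≡ suc ∣ p - x ∣
∣p∣≡1+∣p-x∣ {p = inside  ∷ p} here        = cong (suc ∘ ∣_∣) (sym (Subsetₚ.p─⊥≡p p))
∣p∣≡1+∣p-x∣ {p = inside  ∷ p} (there x∈p) = cong suc (∣p∣≡1+∣p-x∣ x∈p)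
∣p∣≡1+∣p-x∣ {p = outside ∷ p} (there x∈p) = ∣p∣≡1+∣p-x∣ x∈p

x∉p-x : ∀ {n} (p : Subset n) x → x ∉ p - x
x∉p-x (b ∷ p) zero    ()
x∉p-x (b ∷ p) (suc x) (there x∈p-x) = x∉p-x p x x∈p-x

injection⇒∣p∣≤∣q∣ : ∀ {n} (f : Fin n → Fin n) → Injective _≡_ _≡_ f →
                    ∀ {p q} → (∀ {x} → x ∈ p → f x ∈ q) → ∣ p ∣ ≤ ∣ q ∣
injection⇒∣p∣≤∣q∣ {n} f inj = go _ refl
  where
  go : ∀ k {p q} → ∣ p ∣ ≡ k → (∀ {x} → x ∈ p → f x ∈ q) → ∣ p ∣ ≤ ∣ q ∣
  go zero    ∣p∣≡0 _ = subst (_≤ _) (sym ∣p∣≡0) z≤n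
  go (suc k) {p} {q} ∣p∣≡k maps with Subsetₚ.nonempty? p
  ... | no empty = ⊥-elim (ℕₚ.0≢1+n (trans (sym ∣p∣≡0) ∣p∣≡k))
    where
    ∣p∣≡0 : ∣ p ∣ ≡ 0
    ∣p∣≡0 = trans (cong ∣_∣ (Subsetₚ.Empty-unique empty)) (Subsetₚ.∣⊥∣≡0 n)
  ... | yes (x , x∈p) = begin
    ∣ p ∣           ≡⟨ ∣p∣≡1+∣p-x∣ x∈p ⟩
    suc ∣ p - x ∣   ≤⟨ s≤s (go k (ℕₚ.suc-injective (trans (sym (∣p∣≡1+∣p-x∣ x∈p)) ∣p∣≡k)) maps-x) ⟩
    suc ∣ q - f x ∣ ≡⟨ ∣p∣≡1+∣p-x∣ (maps x∈p) ⟨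
    ∣ q ∣           ∎
    where
    open ℕₚ.≤-Reasoning
    maps-x : ∀ {y} → y ∈ p - x → f y ∈ q - f x
    maps-x {y} y∈p-x = Subsetₚ.x∈p∧x≢y⇒x∈p-y (maps (Subsetₚ.p─q⊆p p ⁅ x ⁆ y∈p-x))
                         (λ fy≡fx → x∉p-x p x (subst (_∈ p - x) (inj fy≡fx) y∈p-x))

x∈p⇒⁅x⁆⊆p : ∀ {n} {p : Subset n} {x} → x ∈ p → ⁅ x ⁆ ⊆ p
x∈p⇒⁅x⁆⊆p {x = x} x∈p y∈⁅x⁆ rewrite Subsetₚ.x∈⁅y⁆⇒x≡y x y∈⁅x⁆ = x∈p

p⊆q∧∣q∣≤∣p∣⇒p≡q : ∀ {n} {p q : Subset n} → p ⊆ q → ∣ q ∣ ≤ ∣ p ∣ → p ≡ q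
p⊆q∧∣q∣≤∣p∣⇒p≡q {p = p} {q} p⊆q ∣q∣≤∣p∣ = Subsetₚ.⊆-antisym p⊆q q⊆p
  where
  q⊆p : q ⊆ p
  q⊆p {y} y∈q with y Subsetₚ.∈? p
  ... | yes y∈p = y∈p
  ... | no  y∉p = ⊥-elim (ℕₚ.<⇒≱ (Subsetₚ.p⊂q⇒∣p∣<∣q∣ (p⊆q , y , y∈q , y∉p)) ∣q∣≤∣p∣)

-- Families of subsets and partitions

module _ {n : ℕ} where

  ≐-refl : {F : Fam n} → F ≐ F
  ≐-refl C = id , id

  ≐-sym : {F G : Fam n} → F ≐ G → G ≐ F
  ≐-sym F≐G C = proj₂ (F≐G C) , proj₁ (F≐G C)

  ≐-trans : {F G K : Fam n} → F ≐ G → G ≐ K → F ≐ K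
  ≐-trans F≐G G≐K C = proj₁ (G≐K C) ∘ proj₁ (F≐G C) , proj₂ (F≐G C) ∘ proj₂ (G≐K C)

  ≟ˢ : (A B : Subset n) → Dec (A ≡ B)
  ≟ˢ = Vecₚ.≡-dec Bool._≟_

  DecFam : Fam n → Set
  DecFam F = ∀ C → Dec (F C)

  ∀-Subset? : {P : Subset n → Set} → Decidable P → Dec (∀ C → P C)
  ∀-Subset? P? with Subsetₚ.anySubset? (¬? ∘ P?)
  ... | yes (C , ¬PC) = no λ ∀P → ¬PC (∀P C)
  ... | no  ¬∃¬P      = yes λ C → decidable-stable (P? C) (λ ¬PC → ¬∃¬P (C , ¬PC))

  ≐? : {F G : Fam n} → DecFam F → DecFam G → Dec (F ≐ G)
  ≐? F? G? = ∀-Subset? λ C → (F? C →-dec G? C) ×-dec (G? C →-dec F? C)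

  module Partition {H : Fam n} (part : IsPartition H) where

    block : Fin n → Subset n
    block x = proj₁ (proj₂ (proj₂ part) x)

    block∈H : ∀ x → H (block x)
    block∈H x = proj₁ (proj₂ (proj₂ (proj₂ part) x))

    x∈block : ∀ x → x ∈ block x
    x∈block x = proj₂ (proj₂ (proj₂ (proj₂ part) x))

    blocks-≡ : ∀ {A B x} → H A → H B → x ∈ A → x ∈ B → A ≡ B
    blocks-≡ {A} {B} A∈H B∈H x∈A x∈B with proj₁ (proj₂ part) A B A∈H B∈H
    ... | inj₁ A≡B   = A≡B
    ... | inj₂ empty = ⊥-elim (empty (_ , Subsetₚ.x∈p∩q⁺ (x∈A , x∈B)))

    ≡block : ∀ {A x} → H A → x ∈ A → A ≡ block x
    ≡block A∈H x∈A = blocks-≡ A∈H (block∈H _) x∈A (x∈block _)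

    H? : DecFam H
    H? C with Finₚ.any? (λ x → ≟ˢ C (block x))
    ... | yes (x , C≡block) = yes (subst H (sym C≡block) (block∈H x))
    ... | no  ¬∃           = no λ C∈H → let (c , c∈C) = proj₁ part C C∈H in ¬∃ (c , ≡block C∈H c∈C)

-- Products of subsets and ℋ-sequences

anyFin-true⁻ : ∀ {k} (f : Fin k → Bool) → anyFin f ≡ true → ∃[ i ] f i ≡ true
anyFin-true⁻ {zero}  f ()
anyFin-true⁻ {suc k} f eq with f zero in f₀
... | true  = zero , f₀
... | false with anyFin-true⁻ (f ∘ suc) eq
...   | i , fi = suc i , fi

anyFin-true⁺ : ∀ {k} (f : Fin k → Bool) {i} → f i ≡ true → anyFin f ≡ true
anyFin-true⁺ f {zero}  fi rewrite fi = refl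
anyFin-true⁺ f {suc i} fi with f zero
... | true  = refl
... | false = anyFin-true⁺ (f ∘ suc) fi

∧-true⁻ : ∀ {x y} → x ∧ y ≡ true → x ≡ true × y ≡ true
∧-true⁻ {true} eq = refl , eq

module Operation {n : ℕ} (_∙_ : Fin n → Fin n → Fin n) where

  infixl 6 _⊗_ _⊗*_ _∙*_
  infixl 30 _^_

  _⊗_ : Subset n → Subset n → Subset n
  _⊗_ = _⊛_ _∙_

  _⊗*_ : Subset n → List (Subset n) → Subset n
  _⊗*_ = applySeq _∙_

  _∙*_ : Fin n → List (Fin n) → Fin n
  _∙*_ = foldl _∙_

  _^_ : Fam n → ℕ → Fam n
  H ^ j = Pow _∙_ j H

  Seq : Fam n → ℕ → List (Subset n) → Set
  Seq = SeqFrom _∙_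

  ∈-⊗⁻ : ∀ {A B c} → c ∈ A ⊗ B → ∃[ a ] ∃[ b ] (a ∈ A × b ∈ B × a ∙ b ≡ c)
  ∈-⊗⁻ {A} {B} {c} c∈A⊗B
    with anyFin-true⁻ _ (trans (sym (Vecₚ.lookup∘tabulate _ c)) (Vecₚ.[]=⇒lookup c∈A⊗B))
  ... | a , some-b with anyFin-true⁻ _ some-b
  ... | b , hit with ∧-true⁻ {lookup A a} hit
  ... | a∈A , rest with ∧-true⁻ {lookup B b} rest
  ... | b∈B , ab≡c = a , b , Vecₚ.lookup⇒[]= a A a∈A , Vecₚ.lookup⇒[]= b B b∈B ,
                     toWitness (Equivalence.from T-≡ ab≡c)

  ∈-⊗⁺ : ∀ {A B a b} → a ∈ A → b ∈ B → a ∙ b ∈ A ⊗ B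
  ∈-⊗⁺ {A} {B} {a} {b} a∈A b∈B = Vecₚ.lookup⇒[]= (a ∙ b) (A ⊗ B)
    (trans (Vecₚ.lookup∘tabulate _ (a ∙ b)) (anyFin-true⁺ _ {a} (anyFin-true⁺ _ {b} hit)))
    where
    hit : lookup A a ∧ lookup B b ∧ ⌊ a ∙ b ≟ a ∙ b ⌋ ≡ true
    hit rewrite Vecₚ.[]=⇒lookup a∈A | Vecₚ.[]=⇒lookup b∈B = Equivalence.to T-≡ (fromWitness refl)

  ⊗-mono : ∀ {A A′ B B′} → A ⊆ A′ → B ⊆ B′ → A ⊗ B ⊆ A′ ⊗ B′
  ⊗-mono A⊆A′ B⊆B′ c∈A⊗B with ∈-⊗⁻ c∈A⊗B
  ... | a , b , a∈A , b∈B , refl = ∈-⊗⁺ (A⊆A′ a∈A) (B⊆B′ b∈B)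

  ⊗*-monoˡ : ∀ {A A′} Xs → A ⊆ A′ → A ⊗* Xs ⊆ A′ ⊗* Xs
  ⊗*-monoˡ []       A⊆A′ = A⊆A′
  ⊗*-monoˡ (X ∷ Xs) A⊆A′ = ⊗*-monoˡ Xs (⊗-mono {B = X} A⊆A′ id)

  ⊗*-++ : ∀ A Xs Ys → A ⊗* (Xs ++ Ys) ≡ A ⊗* Xs ⊗* Ys
  ⊗*-++ A []       Ys = refl
  ⊗*-++ A (X ∷ Xs) Ys = ⊗*-++ (A ⊗ X) Xs Ys

  ⊗*-concat-replicate : ∀ {B T} → B ⊗* T ≡ B → ∀ k → B ⊗* concat (replicate k T) ≡ B
  ⊗*-concat-replicate             fixed zero    = refl
  ⊗*-concat-replicate {B} {T} fixed (suc k) = begin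
    B ⊗* (T ++ concat (replicate k T)) ≡⟨ ⊗*-++ B T _ ⟩
    B ⊗* T ⊗* concat (replicate k T)   ≡⟨ cong (_⊗* concat (replicate k T)) fixed ⟩
    B ⊗* concat (replicate k T)        ≡⟨ ⊗*-concat-replicate fixed k ⟩
    B                                  ∎
    where open ≡-Reasoning

  ∙*-concat-replicate : ∀ x ws k → x ∙* concat (replicate k ws) ≡ iterate (_∙* ws) x k
  ∙*-concat-replicate x ws zero    = refl
  ∙*-concat-replicate x ws (suc k) =
    trans (Listₚ.foldl-++ _∙_ x ws _) (∙*-concat-replicate (x ∙* ws) ws k)

  ∈-⊗*⁺ : ∀ {A a ws Xs} → a ∈ A → Pointwise _∈_ ws Xs → a ∙* ws ∈ A ⊗* Xs
  ∈-⊗*⁺ a∈A []             = a∈A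
  ∈-⊗*⁺ a∈A (w∈X ∷ ws∈Xs) = ∈-⊗*⁺ (∈-⊗⁺ a∈A w∈X) ws∈Xs

  ∈-⊗*⁻ : ∀ {A c} Xs → c ∈ A ⊗* Xs → ∃[ a ] ∃[ ws ] (a ∈ A × Pointwise _∈_ ws Xs × a ∙* ws ≡ c)
  ∈-⊗*⁻         []       c∈A = _ , [] , c∈A , [] , refl
  ∈-⊗*⁻ {A} {c} (X ∷ Xs) c∈  with ∈-⊗*⁻ Xs c∈
  ... | a′ , ws , a′∈A⊗X , ws∈Xs , a′ws≡c with ∈-⊗⁻ a′∈A⊗X
  ... | a , w , a∈A , w∈X , refl = a , w ∷ ws , a∈A , w∈X ∷ ws∈Xs , a′ws≡c

  ∈-⊗*-++ : ∀ {A a b} Xs {Ys} → a ∈ A ⊗* Xs → b ∈ ⁅ a ⁆ ⊗* Ys → b ∈ A ⊗* (Xs ++ Ys)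
  ∈-⊗*-++ {A} Xs {Ys} a∈ b∈ = subst (_ ∈_) (sym (⊗*-++ A Xs Ys)) (⊗*-monoˡ Ys (x∈p⇒⁅x⁆⊆p a∈) b∈)

  ∈-singletons : ∀ (ws : List (Fin n)) → Pointwise _∈_ ws (map ⁅_⁆ ws)
  ∈-singletons []       = []
  ∈-singletons (w ∷ ws) = Subsetₚ.x∈⁅x⁆ w ∷ ∈-singletons ws

  ∈-⊗*-singletons⁻ : ∀ {A c} ws → c ∈ A ⊗* map ⁅_⁆ ws → ∃[ a ] (a ∈ A × a ∙* ws ≡ c)
  ∈-⊗*-singletons⁻ []       c∈A = _ , c∈A , refl
  ∈-⊗*-singletons⁻ (w ∷ ws) c∈  with ∈-⊗*-singletons⁻ ws c∈
  ... | a′ , a′∈A⊗w , a′ws≡c with ∈-⊗⁻ a′∈A⊗w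
  ... | a , w′ , a∈A , w′∈⁅w⁆ , refl =
    a , a∈A , subst (λ v → a ∙ v ∙* ws ≡ _) (Subsetₚ.x∈⁅y⁆⇒x≡y w w′∈⁅w⁆) a′ws≡c

  ⊗*-identity-word : ∀ {ws} → (∀ x → x ∙* ws ≡ x) → ∀ A → A ⊗* map ⁅_⁆ ws ≡ A
  ⊗*-identity-word {ws} identity A = Subsetₚ.⊆-antisym
    (λ c∈ → let (a , a∈A , aws≡c) = ∈-⊗*-singletons⁻ ws c∈ in subst (_∈ A) (trans (sym (identity a)) aws≡c) a∈A)
    (λ {a} a∈A → subst (_∈ A ⊗* map ⁅_⁆ ws) (identity a) (∈-⊗*⁺ {A = A} {ws = ws} a∈A (∈-singletons ws)))

  star-cong : ∀ {F G} → F ≐ G → star _∙_ F ≐ star _∙_ G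
  star-cong F≐G C = (λ { (A , B , A∈ , B∈ , eq) → A , B , proj₁ (F≐G A) A∈ , proj₁ (F≐G B) B∈ , eq })
                  , (λ { (A , B , A∈ , B∈ , eq) → A , B , proj₂ (F≐G A) A∈ , proj₂ (F≐G B) B∈ , eq })

  ^-cong : ∀ {F G} → F ≐ G → ∀ j → F ^ j ≐ G ^ j
  ^-cong F≐G zero    = F≐G
  ^-cong F≐G (suc j) = star-cong (^-cong F≐G j)

  ^-+ : ∀ H a b → H ^ (a + b) ≡ H ^ b ^ a
  ^-+ H zero    b = refl
  ^-+ H (suc a) b = cong (star _∙_) (^-+ H a b)

  ^-shift : ∀ {H} L → H ^ L ≐ H → ∀ j → H ^ (j + L) ≐ H ^ j
  ^-shift {H} L period j = subst (_≐ H ^ j) (sym (^-+ H j L)) (^-cong period j)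

  ^-multiple : ∀ {H} p → H ^ p ≐ H → ∀ t → H ^ (t * p) ≐ H
  ^-multiple p period zero    = ≐-refl
  ^-multiple p period (suc t) = ≐-trans (^-shift (t * p) (^-multiple p period t) p) period

  ^-∣ : ∀ {H p L} → H ^ p ≐ H → p ∣ L → H ^ L ≐ H
  ^-∣ {p = p} period (divides t refl) = ^-multiple p period t

  Seq-cong : ∀ {F G} → F ≐ G → ∀ j Xs → Seq F j Xs → Seq G j Xs
  Seq-cong F≐G j []       tt         = tt
  Seq-cong F≐G j (X ∷ Xs) (X∈ , Xs∈) = proj₁ (^-cong F≐G j X) X∈ , Seq-cong F≐G (suc j) Xs Xs∈

  Seq-shift : ∀ {H} L → H ^ L ≐ H → ∀ j Xs → Seq H j Xs → Seq H (j + L) Xs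
  Seq-shift L period j []       tt         = tt
  Seq-shift L period j (X ∷ Xs) (X∈ , Xs∈) = proj₂ (^-shift L period j X) X∈ , Seq-shift L period (suc j) Xs Xs∈

  Seq-++ : ∀ {H} j Xs {Ys} → Seq H j Xs → Seq H (j + length Xs) Ys → Seq H j (Xs ++ Ys)
  Seq-++ {H} j []       {Ys} tt         Ys∈ = subst (λ i → Seq H i Ys) (ℕₚ.+-identityʳ j) Ys∈
  Seq-++ {H} j (X ∷ Xs) {Ys} (X∈ , Xs∈) Ys∈ =
    X∈ , Seq-++ (suc j) Xs Xs∈ (subst (λ i → Seq H i Ys) (ℕₚ.+-suc j (length Xs)) Ys∈)

  Seq-⊗* : ∀ {H A} j Xs → (H ^ j) A → Seq H j Xs → (H ^ (j + length Xs)) (A ⊗* Xs)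
  Seq-⊗* {H} {A} j []       A∈ tt         = subst (λ i → (H ^ i) A) (sym (ℕₚ.+-identityʳ j)) A∈
  Seq-⊗* {H} {A} j (X ∷ Xs) A∈ (X∈ , Xs∈) = subst (λ i → (H ^ i) (A ⊗* (X ∷ Xs))) (sym (ℕₚ.+-suc j (length Xs)))
    (Seq-⊗* (suc j) Xs (A , X , A∈ , X∈ , refl) Xs∈)

  ^-nonempty : ∀ {H} → (∀ A → H A → Nonempty A) → ∀ j {C} → (H ^ j) C → Nonempty C
  ^-nonempty nonempty zero    {C} C∈ = nonempty C C∈
  ^-nonempty nonempty (suc j) (A , B , A∈ , B∈ , refl) with ^-nonempty nonempty j A∈ | ^-nonempty nonempty j B∈
  ... | a , a∈A | b , b∈B = a ∙ b , ∈-⊗⁺ a∈A b∈B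

  Seq⇒word : ∀ {H} → (∀ A → H A → Nonempty A) → ∀ j Xs → Seq H j Xs → ∃[ ws ] Pointwise _∈_ ws Xs
  Seq⇒word nonempty j []       tt         = [] , []
  Seq⇒word nonempty j (X ∷ Xs) (X∈ , Xs∈) with ^-nonempty nonempty j X∈ | Seq⇒word nonempty (suc j) Xs Xs∈
  ... | w , w∈X | ws , ws∈Xs = w ∷ ws , w∈X ∷ ws∈Xs

  Reaches : Fam n → Fin n → ℕ → Set
  Reaches H x m = ∀ G → (H ^ m) G → ∃[ Xs ] (IsHSeq _∙_ H Xs × length Xs ≡ m × ⁅ x ⁆ ⊗* Xs ≡ G)

  Reaches-suc : ∀ {H x m} → Reaches H x m → Reaches H x (suc m)
  Reaches-suc {H} {x} {m} reach G (A , B , A∈ , B∈ , refl) with reach A A∈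
  ... | Xs , Xs∈ , |Xs|≡m , xXs≡A = Xs ++ [ B ] ,
        Seq-++ 0 Xs Xs∈ (subst (λ i → Seq H i [ B ]) (sym |Xs|≡m) (B∈ , tt)) ,
        trans (Listₚ.length-++ Xs) (trans (cong (_+ 1) |Xs|≡m) (ℕₚ.+-comm m 1)) ,
        trans (⊗*-++ ⁅ x ⁆ Xs [ B ]) (cong (_⊗ B) xXs≡A)

  Reaches-mono : ∀ {H x m s} → m ≤ s → Reaches H x m → Reaches H x s
  Reaches-mono {H} {x} m≤s = go (ℕₚ.≤⇒≤′ m≤s)
    where
    go : ∀ {m s} → m ≤′ s → Reaches H x m → Reaches H x s
    go ≤′-refl        reach = reach
    go (≤′-step m≤′s) reach = Reaches-suc (go m≤′s reach)

  Reaches-cong : ∀ {F G x m} → F ≐ G → Reaches F x m → Reaches G x m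
  Reaches-cong {m = m} F≐G reach C C∈ with reach C (proj₂ (^-cong F≐G m C) C∈)
  ... | Xs , Xs∈ , |Xs|≡m , xXs≡C = Xs , Seq-cong F≐G 0 Xs Xs∈ , |Xs|≡m , xXs≡C

  ∙*-toList : ∀ {k} a (xs : Vec (Fin n) k) → Vec.foldl (λ _ → Fin n) _∙_ a xs ≡ a ∙* Vec.toList xs
  ∙*-toList a []       = refl
  ∙*-toList a (x ∷ xs) = ∙*-toList (a ∙ x) xs

  ∙*-fromList : ∀ a ws → Vec.foldl (λ _ → Fin n) _∙_ a (Vec.fromList ws) ≡ a ∙* ws
  ∙*-fromList a []       = refl
  ∙*-fromList a (w ∷ ws) = ∙*-fromList (a ∙ w) ws

  Connectable : ℕ → Set
  Connectable l = ∀ k a b → ∃[ ws ] (length ws ≡ suc k * l × a ∙* ws ≡ b)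

  ergodic⇒connectable : Ergodic _∙_ → ∃[ l ] Connectable l
  ergodic⇒connectable (l , _ , connect) = l , words
    where
    word : ∀ a b → ∃[ ws ] (length ws ≡ l × a ∙* ws ≡ b)
    word a b with connect a b
    ... | xs , axs≡b = Vec.toList xs , Vecₚ.length-toList xs , trans (sym (∙*-toList a xs)) axs≡b

    words : Connectable l
    words zero    a b with word a b
    ... | ws , |ws|≡l , aws≡b = ws , trans |ws|≡l (sym (ℕₚ.+-identityʳ l)) , aws≡b
    words (suc k) a b with word a a | words k a b
    ... | ws , |ws|≡l , aws≡a | vs , |vs|≡ , avs≡b =
      ws ++ vs , trans (Listₚ.length-++ ws) (cong₂ _+_ |ws|≡l |vs|≡) ,
      trans (Listₚ.foldl-++ _∙_ a ws vs) (trans (cong (_∙* vs) aws≡a) avs≡b)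

  star? : ∀ {F} → DecFam F → DecFam (star _∙_ F)
  star? F? C = Subsetₚ.anySubset? λ A → Subsetₚ.anySubset? λ B → F? A ×-dec F? B ×-dec ≟ˢ C (A ⊗ B)

  ^? : ∀ {F} → DecFam F → ∀ j → DecFam (F ^ j)
  ^? F? zero    = F?
  ^? F? (suc j) = star? (^? F? j)

  least-period : ∀ {H} → IsPartition H → Periodic _∙_ H → ∃[ p ] IsPer _∙_ H (suc p)
  least-period {H} part (p , p>0 , period)
    with least-witness (λ m → (0 ℕₚ.<? m) ×-dec ≐? (^? (Partition.H? part) m) (Partition.H? part)) (p>0 , period)
  ... | suc q , (_ , q-period) , below = q , s≤s z≤n , q-period , λ m m>0 m<q m-period → below m<q (m>0 , m-period)
  ... | zero  , (() , _) , _

  IsPer-unique : ∀ {H a b} → IsPer _∙_ H a → IsPer _∙_ H b → a ≡ b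
  IsPer-unique (a>0 , a-period , a-least) (b>0 , b-period , b-least) =
    ℕₚ.≤-antisym (ℕₚ.≮⇒≥ λ b<a → a-least _ b>0 b<a b-period) (ℕₚ.≮⇒≥ λ a<b → b-least _ a>0 a<b a-period)

-- Uniformity preserving operations

module Uniform {n : ℕ} {_∙_ : Fin n → Fin n → Fin n} (up : UniformityPreserving _∙_) where

  open Operation _∙_

  _/_ : Fin n → Fin n → Fin n
  c / b = proj₁ (proj₂ (up b) c)

  /-∙ : ∀ c b → (c / b) ∙ b ≡ c
  /-∙ c b = proj₂ (proj₂ (up b) c) refl

  ∙-cancelʳ : ∀ b → Injective _≡_ _≡_ (_∙ b)
  ∙-cancelʳ b = proj₁ (up b)

  ∙*-injective : ∀ ws → Injective _≡_ _≡_ (_∙* ws)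
  ∙*-injective []       eq = eq
  ∙*-injective (w ∷ ws) eq = ∙-cancelʳ w (∙*-injective ws eq)

  ∙*-surjective : ∀ ws y → ∃[ u ] u ∙* ws ≡ y
  ∙*-surjective []       y = y , refl
  ∙*-surjective (w ∷ ws) y with ∙*-surjective ws y
  ... | u , uws≡y = u / w , subst (λ v → v ∙* ws ≡ y) (sym (/-∙ u w)) uws≡y

  ∃-identity-power : ∀ ws → ∃[ N ] (N > 0 × ∀ x → x ∙* concat (replicate N ws) ≡ x)
  ∃-identity-power ws with injective⇒periodic (_∙* ws) (∙*-injective ws)
  ... | N , N>0 , periodic = N , N>0 , λ x → trans (∙*-concat-replicate x ws N) (periodic x)

  ⊗*-singletons-cancel : ∀ ws {A B} → A ⊗* map ⁅_⁆ ws ≡ B ⊗* map ⁅_⁆ ws → A ≡ B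
  ⊗*-singletons-cancel ws {A} {B} eq = Subsetₚ.⊆-antisym (⊆ eq) (⊆ (sym eq))
    where
    ⊆ : ∀ {A B} → A ⊗* map ⁅_⁆ ws ≡ B ⊗* map ⁅_⁆ ws → A ⊆ B
    ⊆ {A} {B} eq {a} a∈A with ∈-⊗*-singletons⁻ ws (subst (a ∙* ws ∈_) eq (∈-⊗*⁺ {A = A} {ws = ws} a∈A (∈-singletons ws)))
    ... | b , b∈B , bws≡aws = subst (_∈ B) (∙*-injective ws bws≡aws) b∈B

  ∣A∣≤∣A⊗B∣ : ∀ {A B b} → b ∈ B → ∣ A ∣ ≤ ∣ A ⊗ B ∣
  ∣A∣≤∣A⊗B∣ {A} {B} {b} b∈B = injection⇒∣p∣≤∣q∣ (_∙ b) (∙-cancelʳ b) {A} {A ⊗ B} (λ a∈A → ∈-⊗⁺ a∈A b∈B)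

  ∣A∣≤∣A⊗*Xs∣ : ∀ {A ws} Xs → Pointwise _∈_ ws Xs → ∣ A ∣ ≤ ∣ A ⊗* Xs ∣
  ∣A∣≤∣A⊗*Xs∣ []       []            = ℕₚ.≤-refl
  ∣A∣≤∣A⊗*Xs∣ {A} (X ∷ Xs) (w∈X ∷ ws∈Xs) = ℕₚ.≤-trans (∣A∣≤∣A⊗B∣ {A} w∈X) (∣A∣≤∣A⊗*Xs∣ Xs ws∈Xs)

  Covers : Fam n → Set
  Covers F = ∀ z → ∃[ A ] (F A × z ∈ A)

  -- Every z is a product: z = (z / z) ∙ z.
  ^-covers : ∀ {F} → Covers F → ∀ j → Covers (F ^ j)
  ^-covers cover zero    z = cover z
  ^-covers cover (suc j) z with ^-covers cover j z | ^-covers cover j (z / z)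
  ... | B , B∈ , z∈B | A , A∈ , z/z∈A =
    A ⊗ B , (A , B , A∈ , B∈ , refl) , subst (_∈ A ⊗ B) (/-∙ z z) (∈-⊗⁺ z/z∈A z∈B)

  Seq-along : ∀ {F} → Covers F → ∀ j ws → ∃[ Xs ] (Seq F j Xs × Pointwise _∈_ ws Xs)
  Seq-along cover j []       = [] , tt , []
  Seq-along cover j (w ∷ ws) with ^-covers cover j w | Seq-along cover (suc j) ws
  ... | X , X∈ , w∈X | Xs , Xs∈ , ws∈Xs = X ∷ Xs , (X∈ , Xs∈) , (w∈X ∷ ws∈Xs)

  -- Stable partitions

  module StablePartition {H : Fam n} (part : IsPartition H) (p : ℕ) (period : H ^ suc p ≐ H) where

    open Partition part public

    nonempty : ∀ A → H A → Nonempty A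
    nonempty = proj₁ part

    cover : Covers H
    cover = proj₂ (proj₂ part)

    ⊗*-∈H : ∀ j {A} Zs → (H ^ j) A → Seq H j Zs → suc p ∣ j + length Zs → H (A ⊗* Zs)
    ⊗*-∈H j Zs A∈ Zs∈ q∣ = proj₁ (^-∣ period q∣ _) (Seq-⊗* j Zs A∈ Zs∈)

    -- The padding brings the length j up to the multiple j * (p + 1) of the period.
    completion : ∀ j c → ∃[ Zs ] (Seq H j Zs × Pointwise _∈_ (replicate (j * p) c) Zs ×
                                  length Zs ≡ j * p × ∀ {A} → (H ^ j) A → H (A ⊗* Zs))
    completion j c with Seq-along cover j (replicate (j * p) c)
    ... | Zs , Zs∈ , along = Zs , Zs∈ , along , |Zs|≡ , λ A∈ → ⊗*-∈H j Zs A∈ Zs∈ q∣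
      where
      |Zs|≡ : length Zs ≡ j * p
      |Zs|≡ = trans (sym (Pointwise.Pointwise-length along)) (Listₚ.length-replicate (j * p))
      q∣ : suc p ∣ j + length Zs
      q∣ = subst (suc p ∣_) (trans (ℕₚ.*-suc j p) (cong (j +_) (sym |Zs|≡))) (n∣m*n j)

    Cyclic : List (Subset n) → Set
    Cyclic Xs = IsHSeq _∙_ H Xs × suc p ∣ length Xs

    Cyclic-++ : ∀ {Xs Ys} → Cyclic Xs → Cyclic Ys → Cyclic (Xs ++ Ys)
    Cyclic-++ {Xs} {Ys} (Xs∈ , q∣Xs) (Ys∈ , q∣Ys) =
      Seq-++ 0 Xs Xs∈ (Seq-shift (length Xs) (^-∣ period q∣Xs) 0 Ys Ys∈) ,
      subst (suc p ∣_) (sym (Listₚ.length-++ Xs)) (∣m∣n⇒∣m+n q∣Xs q∣Ys)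

    Cyclic-concat-replicate : ∀ {T} → Cyclic T → ∀ k → Cyclic (concat (replicate k T))
    Cyclic-concat-replicate cyclic zero    = tt , divides 0 refl
    Cyclic-concat-replicate cyclic (suc k) = Cyclic-++ cyclic (Cyclic-concat-replicate cyclic k)

    cyclic-image : ∀ {Xs x y} → Cyclic Xs → y ∈ block x ⊗* Xs → block x ⊗* Xs ≡ block y
    cyclic-image {Xs} {x} (Xs∈ , q∣) y∈ = ≡block (⊗*-∈H 0 Xs (block∈H x) Xs∈ q∣) y∈

    cyclic-fixes-block : ∀ {Xs x} → Cyclic Xs → x ∈ ⁅ x ⁆ ⊗* Xs → block x ⊗* Xs ≡ block x
    cyclic-fixes-block {Xs} {x} cyclic x∈ = cyclic-image cyclic (⊗*-monoˡ Xs (x∈p⇒⁅x⁆⊆p (x∈block x)) x∈)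

    Returns : Fin n → Set
    Returns x = ∃[ Xs ] (Cyclic Xs × ⁅ x ⁆ ⊗* Xs ≡ block x)

    returns-fixes-block : ∀ {Xs x} → Cyclic Xs → ⁅ x ⁆ ⊗* Xs ≡ block x → block x ⊗* Xs ≡ block x
    returns-fixes-block {x = x} cyclic x↦block = cyclic-fixes-block cyclic (subst (x ∈_) (sym x↦block) (x∈block x))

    reaches⇒returns : ∀ {x m} → Reaches H x m → Returns x
    reaches⇒returns {x} {m} reach with ∙*-surjective (replicate (m * p) x) x
    ... | u , u↦x with ^-covers cover m u
    ... | G , G∈ , u∈G with reach G G∈ | completion m x
    ... | Xs , Xs∈ , |Xs|≡m , xXs≡G | Zs , Zs∈ , along , |Zs|≡ , to-block = Xs ++ Zs , cyclic , (begin
      ⁅ x ⁆ ⊗* (Xs ++ Zs) ≡⟨ ⊗*-++ ⁅ x ⁆ Xs Zs ⟩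
      ⁅ x ⁆ ⊗* Xs ⊗* Zs   ≡⟨ cong (_⊗* Zs) xXs≡G ⟩
      G ⊗* Zs             ≡⟨ ≡block (to-block G∈) (subst (_∈ G ⊗* Zs) u↦x (∈-⊗*⁺ u∈G along)) ⟩
      block x             ∎)
      where
      open ≡-Reasoning
      cyclic : Cyclic (Xs ++ Zs)
      cyclic = Seq-++ 0 Xs Xs∈ (subst (λ i → Seq H i Zs) (sym |Xs|≡m) Zs∈) ,
               subst (suc p ∣_) (sym (trans (Listₚ.length-++ Xs) (trans (cong₂ _+_ |Xs|≡m |Zs|≡) (sym (ℕₚ.*-suc m p)))))
                 (n∣m*n m)

    returns⇒reaches : ∀ {l} → Connectable l → ∀ {x} → Returns x → ∃[ m ] Reaches H x m
    returns⇒reaches {l} words {x} (V , (V∈ , q∣V) , xV≡block) = length V + suc p * l , reach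
      where
      q∣m : suc p ∣ length V + suc p * l
      q∣m = ∣m∣n⇒∣m+n q∣V (m∣m*n l)
      reach : Reaches H x (length V + suc p * l)
      reach G G∈ with proj₁ (^-∣ period q∣m G) G∈
      ... | G∈H with nonempty G G∈H
      ... | g , g∈G with words p x g
      ... | ws , |ws|≡ , xws≡g with Seq-along cover (length V) ws
      ... | Zs , Zs∈ , along = V ++ Zs , Seq-++ 0 V V∈ Zs∈ , |V++Zs|≡ , (begin
        ⁅ x ⁆ ⊗* (V ++ Zs) ≡⟨ ⊗*-++ ⁅ x ⁆ V Zs ⟩
        ⁅ x ⁆ ⊗* V ⊗* Zs   ≡⟨ cong (_⊗* Zs) xV≡block ⟩
        block x ⊗* Zs      ≡⟨ blocks-≡ xZs∈H G∈H (subst (_∈ block x ⊗* Zs) xws≡g (∈-⊗*⁺ (x∈block x) along)) g∈G ⟩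
        G                  ∎)
        where
        open ≡-Reasoning
        |Zs|≡ : length Zs ≡ suc p * l
        |Zs|≡ = trans (sym (Pointwise.Pointwise-length along)) |ws|≡
        |V++Zs|≡ : length (V ++ Zs) ≡ length V + suc p * l
        |V++Zs|≡ = trans (Listₚ.length-++ V) (cong (length V +_) |Zs|≡)
        xZs∈H : H (block x ⊗* Zs)
        xZs∈H = ⊗*-∈H (length V) Zs (proj₂ (^-∣ period q∣V _) (block∈H x)) Zs∈
                  (subst (suc p ∣_) (cong (length V +_) (sym |Zs|≡)) q∣m)

    CyclicAugmenting : List (Subset n) → Set
    CyclicAugmenting Xs = Cyclic Xs × (∀ A → A ⊆ A ⊗* Xs)

    CyclicAugmenting-++ : ∀ {Xs Ys} → CyclicAugmenting Xs → CyclicAugmenting Ys → CyclicAugmenting (Xs ++ Ys)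
    CyclicAugmenting-++ {Xs} {Ys} (Xs-cyclic , Xs-aug) (Ys-cyclic , Ys-aug) =
      Cyclic-++ Xs-cyclic Ys-cyclic ,
      λ A a∈A → subst (_ ∈_) (sym (⊗*-++ A Xs Ys)) (Ys-aug (A ⊗* Xs) (Xs-aug A a∈A))

    gather-along : ∀ {A S} → (∀ {b} → b ∈ S → ∃[ Xs ] (CyclicAugmenting Xs × b ∈ A ⊗* Xs)) →
                   ∀ {k} (g : Fin k → Fin n) → ∃[ Xs ] (CyclicAugmenting Xs × ∀ i → g i ∈ S → g i ∈ A ⊗* Xs)
    gather-along reach {zero}  g = [] , ((tt , divides 0 refl) , λ _ → id) , λ ()
    gather-along {A} {S} reach {suc k} g with gather-along reach (g ∘ suc) | g zero Subsetₚ.∈? S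
    ... | Ys , Ys-aug , Ys-reach | no g₀∉S =
      Ys , Ys-aug , λ { zero g₀∈S → ⊥-elim (g₀∉S g₀∈S) ; (suc i) → Ys-reach i }
    ... | Ys , Ys-aug , Ys-reach | yes g₀∈S with reach g₀∈S
    ...   | Xs , Xs-aug , g₀∈ = Xs ++ Ys , CyclicAugmenting-++ Xs-aug Ys-aug , λ where
      zero    _    → subst (_ ∈_) (sym (⊗*-++ A Xs Ys)) (proj₂ Ys-aug _ g₀∈)
      (suc i) gi∈S → subst (_ ∈_) (sym (⊗*-++ A Xs Ys)) (⊗*-monoˡ Ys (proj₂ Xs-aug A) (Ys-reach i gi∈S))

    gather : ∀ {A S} → (∀ {b} → b ∈ S → ∃[ Xs ] (CyclicAugmenting Xs × b ∈ A ⊗* Xs)) →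
             ∃[ Xs ] (CyclicAugmenting Xs × S ⊆ A ⊗* Xs)
    gather reach with gather-along reach id
    ... | Xs , aug , reached = Xs , aug , λ {b} → reached b

    common-return : (∀ x → Returns x) → ∀ {a b} → b ∈ block a →
                    ∃[ T ] (Cyclic T × ⁅ a ⁆ ⊗* T ≡ block a × ⁅ b ⁆ ⊗* T ≡ block a)
    common-return returns {a} {b} b∈a with returns a
    ... | Va , Va-cyclic , a↦a with Seq⇒word nonempty 0 Va (proj₁ Va-cyclic)
    ... | ws , along with returns (b ∙* ws)
    ... | Vc , Vc-cyclic , c↦c = Va ++ Vc , Cyclic-++ Va-cyclic Vc-cyclic , a↦ , b↦
      where
      c : Fin n
      c = b ∙* ws
      a-fixed : block a ⊗* Va ≡ block a
      a-fixed = returns-fixes-block Va-cyclic a↦a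
      c∈bVa : c ∈ ⁅ b ⁆ ⊗* Va
      c∈bVa = ∈-⊗*⁺ (Subsetₚ.x∈⁅x⁆ b) along
      c≡a : block c ≡ block a
      c≡a = sym (≡block (block∈H a) (subst (c ∈_) a-fixed (⊗*-monoˡ Va (x∈p⇒⁅x⁆⊆p b∈a) c∈bVa)))
      a-fixed′ : block a ⊗* Vc ≡ block a
      a-fixed′ = subst (λ B → B ⊗* Vc ≡ B) c≡a (returns-fixes-block Vc-cyclic c↦c)
      a-fixed″ : block a ⊗* (Va ++ Vc) ≡ block a
      a-fixed″ = trans (⊗*-++ (block a) Va Vc) (trans (cong (_⊗* Vc) a-fixed) a-fixed′)
      a↦ : ⁅ a ⁆ ⊗* (Va ++ Vc) ≡ block a
      a↦ = trans (⊗*-++ ⁅ a ⁆ Va Vc) (trans (cong (_⊗* Vc) a↦a) a-fixed′)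
      b↦ : ⁅ b ⁆ ⊗* (Va ++ Vc) ≡ block a
      b↦ = Subsetₚ.⊆-antisym
        (λ y∈ → subst (_ ∈_) a-fixed″ (⊗*-monoˡ (Va ++ Vc) (x∈p⇒⁅x⁆⊆p b∈a) y∈))
        (λ y∈ → ∈-⊗*-++ Va c∈bVa (subst (_ ∈_) (sym (trans c↦c c≡a)) y∈))

    augmenting-power : ∀ {T} → Cyclic T → ∃[ k ] CyclicAugmenting (concat (replicate (suc k) T))
    augmenting-power {T} cyclic with Seq⇒word nonempty 0 T (proj₁ cyclic)
    ... | ws , along with ∃-identity-power ws
    ... | suc k , _ , identity = k , Cyclic-concat-replicate cyclic (suc k) , λ A {y} y∈A →
          subst (_∈ A ⊗* concat (replicate (suc k) T)) (identity y)
            (∈-⊗*⁺ y∈A (Pointwise.concat⁺ (Pointwise.replicate⁺ along (suc k))))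

    module Least (least : IsPer _∙_ H (suc p)) where

      augmenting⇒cyclic : ∀ {Xs} → Augmenting _∙_ H Xs → CyclicAugmenting Xs
      augmenting⇒cyclic ((Xs∈ , p′ , p′-least , p′∣) , aug) =
        (Xs∈ , subst (_∣ _) (IsPer-unique p′-least least) p′∣) , aug

      R⇒∈block : ∀ {a b} → R _∙_ H a b → b ∈ block a
      R⇒∈block {a} (Xs , aug , (a∈ , b∈) , _) =
        subst (_ ∈_) (cyclic-fixes-block (proj₁ (augmenting⇒cyclic aug)) a∈)
          (⊗*-monoˡ Xs (x∈p⇒⁅x⁆⊆p (x∈block a)) b∈)

      ∈block⇒R : (∀ x → Returns x) → ∀ {a b} → b ∈ block a → R _∙_ H a b
      ∈block⇒R returns {a} {b} b∈a with common-return returns b∈a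
      ... | T , T-cyclic , a↦ , b↦ with augmenting-power T-cyclic
      ... | k , (Aug∈ , q∣Aug) , aug =
        Aug , ((Aug∈ , suc p , least , q∣Aug) , aug) , (in-a (x∈block a) , in-a b∈a) , (in-b (x∈block a) , in-b b∈a)
        where
        Aug : List (Subset n)
        Aug = concat (replicate (suc k) T)
        power : ∀ {x} → ⁅ x ⁆ ⊗* T ≡ block a → ⁅ x ⁆ ⊗* Aug ≡ block a
        power x↦ = trans (⊗*-++ _ T _) (trans (cong (_⊗* concat (replicate k T)) x↦)
                     (⊗*-concat-replicate (returns-fixes-block T-cyclic a↦) k))
        in-a : ∀ {y} → y ∈ block a → y ∈ ⁅ a ⁆ ⊗* Aug
        in-a = subst (_ ∈_) (sym (power a↦))
        in-b : ∀ {y} → y ∈ block a → y ∈ ⁅ b ⁆ ⊗* Aug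
        in-b = subst (_ ∈_) (sym (power b↦))

      returns⇒K≐H : (∀ x → Returns x) → K _∙_ H ≐ H
      returns⇒K≐H returns C = K⇒H , H⇒K
        where
        K⇒H : K _∙_ H C → H C
        K⇒H (a , class) = subst H (sym C≡a) (block∈H a)
          where
          C≡a : C ≡ block a
          C≡a = Subsetₚ.⊆-antisym (λ {y} y∈C → R⇒∈block (proj₁ (class y) y∈C))
                                  (λ {y} y∈a → proj₂ (class y) (∈block⇒R returns y∈a))
        H⇒K : H C → K _∙_ H C
        H⇒K C∈H with nonempty C C∈H
        ... | a , a∈C = a , λ y → (λ y∈C → ∈block⇒R returns (subst (y ∈_) C≡a y∈C))
                                , (λ Ray → subst (y ∈_) (sym C≡a) (R⇒∈block Ray))
          where
          C≡a : C ≡ block a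
          C≡a = ≡block C∈H a∈C

      reach-through-R : ∀ {x a Xa} → Augmenting _∙_ H Xa → a ∈ ⁅ x ⁆ ⊗* Xa →
            ∀ {b} → R _∙_ H a b → ∃[ Xs ] (CyclicAugmenting Xs × b ∈ ⁅ x ⁆ ⊗* Xs)
      reach-through-R {Xa = Xa} Xa-aug a∈xXa (Xb , Xb-aug , (_ , b∈aXb) , _) =
        Xa ++ Xb , CyclicAugmenting-++ (augmenting⇒cyclic Xa-aug) (augmenting⇒cyclic Xb-aug) ,
        ∈-⊗*-++ Xa a∈xXa b∈aXb

      K≐H⇒returns : K _∙_ H ≐ H → ∀ x → Returns x
      K≐H⇒returns K≐H x with proj₂ (K≐H (block x)) (block∈H x)
      ... | a , class with proj₁ (class x) (x∈block x)
      ... | Xa , Xa-aug , _ , (a∈xXa , _) with gather (λ b∈x → reach-through-R Xa-aug a∈xXa (proj₁ (class _) b∈x))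
      ... | W , (W-cyclic , _) , x⊆ = W , W-cyclic , Subsetₚ.⊆-antisym
        (λ y∈ → subst (_ ∈_) (cyclic-fixes-block W-cyclic (x⊆ (x∈block x))) (⊗*-monoˡ W (x∈p⇒⁅x⁆⊆p (x∈block x)) y∈))
        x⊆

    module Balanced (balanced : IsBalanced H) where

      ^-size-≥ : ∀ j {C B} → (H ^ j) C → H B → ∣ B ∣ ≤ ∣ C ∣
      ^-size-≥ zero    C∈ B∈ = ℕₚ.≤-reflexive (balanced _ _ B∈ C∈)
      ^-size-≥ (suc j) (A , Y , A∈ , Y∈ , refl) B∈ with ^-nonempty nonempty j Y∈
      ... | y , y∈Y = ℕₚ.≤-trans (^-size-≥ j A∈ B∈) (∣A∣≤∣A⊗B∣ {A} y∈Y)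

      ^-size-≤ : ∀ j {C B} → (H ^ j) C → H B → ∣ C ∣ ≤ ∣ B ∣
      ^-size-≤ j {C} C∈ B∈ with completion j (proj₁ (^-nonempty nonempty j C∈))
      ... | Zs , _ , along , _ , to-block =
        ℕₚ.≤-trans (∣A∣≤∣A⊗*Xs∣ {C} Zs along) (ℕₚ.≤-reflexive (balanced _ _ (to-block C∈) B∈))

      ⊗-singleton : ∀ j {A Y y} → (H ^ j) A → (H ^ j) Y → y ∈ Y → A ⊗ ⁅ y ⁆ ≡ A ⊗ Y
      ⊗-singleton j {A} {Y} {y} A∈ Y∈ y∈Y = p⊆q∧∣q∣≤∣p∣⇒p≡q (⊗-mono {A} {A} {⁅ y ⁆} {Y} id (x∈p⇒⁅x⁆⊆p y∈Y)) (begin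
        ∣ A ⊗ Y ∣     ≤⟨ ^-size-≤ (suc j) (A , Y , A∈ , Y∈ , refl) (block∈H y) ⟩
        ∣ block y ∣   ≤⟨ ^-size-≥ j A∈ (block∈H y) ⟩
        ∣ A ∣         ≤⟨ ∣A∣≤∣A⊗B∣ {A} (Subsetₚ.x∈⁅x⁆ y) ⟩
        ∣ A ⊗ ⁅ y ⁆ ∣ ∎)
        where open ℕₚ.≤-Reasoning

      Seq-singletons : ∀ j {A} Zs {zs} → (H ^ j) A → Seq H j Zs → Pointwise _∈_ zs Zs →
                       A ⊗* Zs ≡ A ⊗* map ⁅_⁆ zs
      Seq-singletons j []       A∈ tt         []            = refl
      Seq-singletons j {A} (Z ∷ Zs) {z ∷ zs} A∈ (Z∈ , Zs∈) (z∈Z ∷ along) = begin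
        A ⊗ Z ⊗* Zs             ≡⟨ Seq-singletons (suc j) Zs (A , Z , A∈ , Z∈ , refl) Zs∈ along ⟩
        A ⊗ Z ⊗* map ⁅_⁆ zs     ≡⟨ cong (_⊗* map ⁅_⁆ zs) (⊗-singleton j A∈ Z∈ z∈Z) ⟨
        A ⊗ ⁅ z ⁆ ⊗* map ⁅_⁆ zs ∎
        where open ≡-Reasoning

      -- A common completion sends C and D into one block, and by rigidity it acts on them as a
      -- sequence of singletons, which cancels.
      ^-blocks-≡ : ∀ t {C D c} → (H ^ t) C → (H ^ t) D → c ∈ C → c ∈ D → C ≡ D
      ^-blocks-≡ t {C} {D} {c} C∈ D∈ c∈C c∈D with completion t c
      ... | Zs , Zs∈ , along , _ , to-block = ⊗*-singletons-cancel (replicate (t * p) c) (begin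
        C ⊗* map ⁅_⁆ (replicate (t * p) c) ≡⟨ Seq-singletons t Zs C∈ Zs∈ along ⟨
        C ⊗* Zs                            ≡⟨ blocks-≡ (to-block C∈) (to-block D∈) (∈-⊗*⁺ c∈C along) (∈-⊗*⁺ c∈D along) ⟩
        D ⊗* Zs                            ≡⟨ Seq-singletons t Zs D∈ Zs∈ along ⟩
        D ⊗* map ⁅_⁆ (replicate (t * p) c) ∎)
        where open ≡-Reasoning

      identity-word-period : ∀ {ws} → (∀ x → x ∙* ws ≡ x) → H ^ length ws ≐ H
      identity-word-period {ws} identity C = ⇒ , ⇐
        where
        ⇐ : ∀ {C} → H C → (H ^ length ws) C
        ⇐ {C} C∈ with Seq-along cover 0 ws
        ... | Zs , Zs∈ , along = subst₂ (λ L D → (H ^ L) D) (sym (Pointwise.Pointwise-length along))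
          (trans (Seq-singletons 0 Zs C∈ Zs∈ along) (⊗*-identity-word {ws} identity C)) (Seq-⊗* 0 Zs C∈ Zs∈)
        ⇒ : (H ^ length ws) C → H C
        ⇒ C∈ with ^-nonempty nonempty (length ws) C∈
        ... | c , c∈C = subst H (sym (^-blocks-≡ (length ws) C∈ (⇐ (block∈H c)) c∈C (x∈block c))) (block∈H c)

      ⊗-left-singleton : (∀ a → Injective _≡_ _≡_ (a ∙_)) → ∀ x {Y} → H Y → ⁅ x ⁆ ⊗ Y ≡ block x ⊗ Y
      ⊗-left-singleton cancelˡ x {Y} Y∈ = p⊆q∧∣q∣≤∣p∣⇒p≡q (⊗-mono {⁅ x ⁆} {block x} {Y} {Y} (x∈p⇒⁅x⁆⊆p (x∈block x)) id) (begin
        ∣ block x ⊗ Y ∣ ≤⟨ ^-size-≤ 1 (block x , Y , block∈H x , Y∈ , refl) Y∈ ⟩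
        ∣ Y ∣           ≤⟨ injection⇒∣p∣≤∣q∣ (x ∙_) (cancelˡ x) {Y} {⁅ x ⁆ ⊗ Y} (∈-⊗⁺ (Subsetₚ.x∈⁅x⁆ x)) ⟩
        ∣ ⁅ x ⁆ ⊗ Y ∣   ∎)
        where open ℕₚ.≤-Reasoning

      -- z is chosen so that the word z ∷ replicate p x, of length p + 1, fixes x.
      quasigroup⇒returns : (∀ a → Injective _≡_ _≡_ (a ∙_)) → (∀ a b → ∃[ y ] a ∙ y ≡ b) → ∀ x → Returns x
      quasigroup⇒returns cancelˡ solve x with ∙*-surjective (replicate p x) x
      ... | u , u↦x with solve x u
      ... | z , xz≡u with Seq-along cover 0 (z ∷ replicate p x)
      ... | X ∷ Xs , (X∈ , Xs∈) , (z∈X ∷ along) = X ∷ Xs , cyclic , (begin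
        ⁅ x ⁆ ⊗ X ⊗* Xs   ≡⟨ cong (_⊗* Xs) (⊗-left-singleton cancelˡ x X∈) ⟩
        block x ⊗ X ⊗* Xs ≡⟨ cyclic-fixes-block cyclic x∈ ⟩
        block x           ∎)
        where
        open ≡-Reasoning
        cyclic : Cyclic (X ∷ Xs)
        cyclic = (X∈ , Xs∈) , subst (λ k → suc p ∣ suc k)
                   (trans (sym (Listₚ.length-replicate p)) (Pointwise.Pointwise-length along)) ∣-refl
        x∈ : x ∈ ⁅ x ⁆ ⊗* (X ∷ Xs)
        x∈ = subst (_∈ ⁅ x ⁆ ⊗* (X ∷ Xs)) (trans (cong (_∙* replicate p x) xz≡u) u↦x)
               (∈-⊗*⁺ (Subsetₚ.x∈⁅x⁆ x) (z∈X ∷ along))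

  stable-period : Fin n → ∃[ L ] (L > 0 × ∀ {H} → Stable _∙_ H → H ^ L ≐ H)
  stable-period e with ∃-identity-power [ e ]
  ... | zero  , ()  , _
  ... | suc k , _ , identity = length (concat (replicate (suc k) [ e ])) , s≤s z≤n , λ where
    (_    , _        , zero  , () , _)
    (part , balanced , suc p , _  , period) → StablePartition.Balanced.identity-word-period
      part p period balanced {concat (replicate (suc k) [ e ])} identity

  ⊤⊗⊤ : ⊤ ⊗ ⊤ ≡ ⊤
  ⊤⊗⊤ = Subsetₚ.⊆-antisym Subsetₚ.⊆⊤ λ {c} _ → subst (_∈ ⊤ ⊗ ⊤) (/-∙ c c) (∈-⊗⁺ Subsetₚ.∈⊤ Subsetₚ.∈⊤)

  OneBlock : Fam n
  OneBlock C = C ≡ ⊤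

  ⊤∈OneBlock^ : ∀ j → (OneBlock ^ j) ⊤
  ⊤∈OneBlock^ zero    = refl
  ⊤∈OneBlock^ (suc j) = ⊤ , ⊤ , ⊤∈OneBlock^ j , ⊤∈OneBlock^ j , sym ⊤⊗⊤

  OneBlock-stable : Fin n → Stable _∙_ OneBlock
  OneBlock-stable e =
    ((λ { _ refl → e , Subsetₚ.∈⊤ }) , (λ { _ _ refl refl → inj₁ refl }) , (λ x → ⊤ , refl , Subsetₚ.∈⊤)) ,
    (λ { _ _ refl refl → refl }) ,
    1 , s≤s z≤n , λ C → (λ { (_ , _ , refl , refl , refl) → ⊤⊗⊤ }) , (λ { refl → ⊤ , ⊤ , refl , refl , sym ⊤⊗⊤ })

  strongly-ergodic⇒ergodic : Fin n → StronglyErgodic _∙_ → Ergodic _∙_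
  strongly-ergodic⇒ergodic e se with Fin-boundedAbove n (λ x → proj₁ (se OneBlock (OneBlock-stable e) x))
  ... | b , m≤b = suc b , s≤s z≤n , connect
    where
    connect : ∀ a c → Σ (Vec (Fin n) (suc b)) (λ xs → Vec.foldl (λ _ → Fin n) _∙_ a xs ≡ c)
    connect a c with Reaches-mono (ℕₚ.m≤n⇒m≤1+n (m≤b a)) (proj₂ (se OneBlock (OneBlock-stable e) a)) ⊤ (⊤∈OneBlock^ (suc b))
    ... | Xs , _ , |Xs|≡ , aXs≡⊤ with ∈-⊗*⁻ Xs (subst (c ∈_) (sym aXs≡⊤) Subsetₚ.∈⊤)
    ... | a′ , ws , a′∈⁅a⁆ , along , a′ws≡c =
      subst (λ k → Σ (Vec (Fin n) k) λ xs → Vec.foldl (λ _ → Fin n) _∙_ a xs ≡ c)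
        (trans (Pointwise.Pointwise-length along) |Xs|≡)
        (Vec.fromList ws , trans (∙*-fromList a ws)
          (subst (λ v → v ∙* ws ≡ c) (Subsetₚ.x∈⁅y⁆⇒x≡y a a′∈⁅a⁆) a′ws≡c))

  ⟦_⟧ : Vec (Subset n) n → Fam n
  ⟦ v ⟧ C = ∃[ i ] C ≡ lookup v i

  ⟦⟧? : ∀ v → DecFam ⟦ v ⟧
  ⟦⟧? v C = Finₚ.any? λ i → ≟ˢ C (lookup v i)

  -- A stable partition is coded by the blocks of the points 0, …, n - 1; testing periodicity at a
  -- period L common to all stable partitions makes the code decidable.
  StableCode : ℕ → Vec (Subset n) n → Set
  StableCode L v =
    (∀ i → Nonempty (lookup v i)) ×
    (∀ i j → lookup v i ≡ lookup v j ⊎ Empty (lookup v i ∩ lookup v j)) ×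
    (∀ x → ∃[ i ] x ∈ lookup v i) ×
    (∀ i j → ∣ lookup v i ∣ ≡ ∣ lookup v j ∣) ×
    ⟦ v ⟧ ^ L ≐ ⟦ v ⟧

  StableCode? : ∀ L v → Dec (StableCode L v)
  StableCode? L v =
    Finₚ.all? (λ i → Subsetₚ.nonempty? (lookup v i)) ×-dec
    Finₚ.all? (λ i → Finₚ.all? λ j → ≟ˢ (lookup v i) (lookup v j) ⊎-dec ¬? (Subsetₚ.nonempty? _)) ×-dec
    Finₚ.all? (λ x → Finₚ.any? λ i → x Subsetₚ.∈? lookup v i) ×-dec
    Finₚ.all? (λ i → Finₚ.all? λ j → ∣ lookup v i ∣ ℕ.≟ ∣ lookup v j ∣) ×-dec
    ≐? (^? (⟦⟧? v) L) (⟦⟧? v)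

  code⇒stable : ∀ {L v} → L > 0 → StableCode L v → Stable _∙_ ⟦ v ⟧
  code⇒stable {L} {v} L>0 (nonempty , disjoint , covers , sizes , period) =
    ((λ { _ (i , refl) → nonempty i }) ,
     (λ { _ _ (i , refl) (j , refl) → disjoint i j }) ,
     (λ x → let (i , x∈) = covers x in lookup v i , (i , refl) , x∈)) ,
    (λ { _ _ (i , refl) (j , refl) → sizes i j }) ,
    L , L>0 , period

  stable⇒code : ∀ {L H} → Stable _∙_ H → H ^ L ≐ H → ∃[ v ] (StableCode L v × H ≐ ⟦ v ⟧)
  stable⇒code {L} {H} (part , balanced , _) period = v , code , H≐v
    where
    open Partition part
    v : Vec (Subset n) n
    v = tabulate block
    lookup-v : ∀ i → lookup v i ≡ block i
    lookup-v = Vecₚ.lookup∘tabulate block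
    H≐v : H ≐ ⟦ v ⟧
    H≐v C = (λ C∈ → let (c , c∈C) = proj₁ part C C∈ in c , trans (≡block C∈ c∈C) (sym (lookup-v c)))
          , λ { (i , refl) → subst H (sym (lookup-v i)) (block∈H i) }
    code : StableCode L v
    code = (λ i → i , subst (i ∈_) (sym (lookup-v i)) (x∈block i)) ,
           (λ i j → subst₂ (λ A B → A ≡ B ⊎ Empty (A ∩ B)) (sym (lookup-v i)) (sym (lookup-v j))
                      (proj₁ (proj₂ part) _ _ (block∈H i) (block∈H j))) ,
           (λ x → x , subst (x ∈_) (sym (lookup-v x)) (x∈block x)) ,
           (λ i j → subst₂ (λ A B → ∣ A ∣ ≡ ∣ B ∣) (sym (lookup-v i)) (sym (lookup-v j))
                      (balanced _ _ (block∈H i) (block∈H j))) ,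
           ≐-trans (^-cong (≐-sym H≐v) L) (≐-trans period H≐v)

  -- There are finitely many codes, so the reaching times of all stable partitions have a common bound.
  strongly-ergodic⇒uniform : Fin n → StronglyErgodic _∙_ →
    ∃[ d ] (d > 0 × ∀ s → s ≥ d → ∀ H → Stable _∙_ H → ∀ x → Reaches H x s)
  strongly-ergodic⇒uniform e se with stable-period e
  ... | L , L>0 , L-period = suc bound , s≤s z≤n , uniform
    where
    time : ∀ {v} → StableCode L v → Fin n → ℕ
    time {v} code x = proj₁ (se ⟦ v ⟧ (code⇒stable {L} {v} L>0 code) x)

    steps : Vec (Subset n) n → ℕ
    steps v with StableCode? L v
    ... | yes code = proj₁ (Fin-boundedAbove n (time code))
    ... | no  _    = 0

    steps-bound : ∀ {v} → StableCode L v → ∀ x → ∃[ m ] (m ≤ steps v × Reaches ⟦ v ⟧ x m)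
    steps-bound {v} code x with StableCode? L v
    ... | yes code′ = time code′ x , proj₂ (Fin-boundedAbove n (time code′)) x ,
                      proj₂ (se ⟦ v ⟧ (code⇒stable {L} {v} L>0 code′) x)
    ... | no ¬code  = ⊥-elim (¬code code)

    bounded : ∃[ b ] (∀ v → steps v ≤ b)
    bounded = Vec-boundedAbove (Vec-boundedAbove Bool-boundedAbove n) n steps

    bound : ℕ
    bound = proj₁ bounded

    uniform : ∀ s → s ≥ suc bound → ∀ H → Stable _∙_ H → ∀ x → Reaches H x s
    uniform s d≤s H stable x with stable⇒code {L} stable (L-period stable)
    ... | v , code , H≐v with steps-bound code x
    ... | m , m≤steps , reach = Reaches-cong (≐-sym H≐v) (Reaches-mono m≤s reach)
      where
      m≤s : m ≤ s
      m≤s = ℕₚ.≤-trans m≤steps (ℕₚ.≤-trans (proj₂ bounded v) (ℕₚ.≤-trans (ℕₚ.n≤1+n bound) d≤s))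

  strongly-ergodic⇔K≐H : Ergodic _∙_ → StronglyErgodic _∙_ ⇔ (∀ H → Stable _∙_ H → K _∙_ H ≐ H)
  strongly-ergodic⇔K≐H ergodic = mk⇔ to from
    where
    to : StronglyErgodic _∙_ → ∀ H → Stable _∙_ H → K _∙_ H ≐ H
    to se H stable@(part , _ , periodic) with least-period part periodic
    ... | p , least = returns⇒K≐H λ x → reaches⇒returns (proj₂ (se H stable x))
      where
      open StablePartition part p (proj₁ (proj₂ least))
      open Least least

    from : (∀ H → Stable _∙_ H → K _∙_ H ≐ H) → StronglyErgodic _∙_
    from K≐H H stable@(part , _ , periodic) x with least-period part periodic
    ... | p , least = returns⇒reaches (proj₂ (ergodic⇒connectable ergodic)) (K≐H⇒returns (K≐H H stable) x)
      where
      open StablePartition part p (proj₁ (proj₂ least))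
      open Least least

  quasigroup⇒strongly-ergodic : IsQuasigroupOp _∙_ → StronglyErgodic _∙_
  quasigroup⇒strongly-ergodic _ H (_ , _ , zero , () , _)
  quasigroup⇒strongly-ergodic (_ , left) H (part , balanced , suc p , _ , period) x =
    returns⇒reaches (proj₂ (ergodic⇒connectable ergodic)) (quasigroup⇒returns cancelˡ solve x)
    where
    open StablePartition part p period
    open Balanced balanced
    cancelˡ : ∀ a → Injective _≡_ _≡_ (a ∙_)
    cancelˡ a = proj₁ (left a)
    solve : ∀ a b → ∃[ y ] a ∙ y ≡ b
    solve a b = proj₁ (proj₂ (left a) b) , proj₂ (proj₂ (left a) b) refl
    ergodic : Ergodic _∙_
    ergodic = 1 , s≤s z≤n , λ a b → proj₁ (solve a b) ∷ [] , proj₂ (solve a b)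

mainTheorem2 : (n : ℕ) (_∙_ : Fin n → Fin n → Fin n) →
    UniformityPreserving _∙_ →
    (StronglyErgodic _∙_ → Ergodic _∙_) ×
    (StronglyErgodic _∙_ → ∃[ d ] (d > 0 × (∀ s → s ≥ d → ∀ H → Stable _∙_ H →
        ∀ x G → Pow _∙_ s H G →
        ∃[ Xs ] (IsHSeq _∙_ H Xs × length Xs ≡ s × applySeq _∙_ ⁅ x ⁆ Xs ≡ G)))) ×
    (Ergodic _∙_ → (StronglyErgodic _∙_ ⇔ (∀ H → Stable _∙_ H → K _∙_ H ≐ H))) ×
    (IsQuasigroupOp _∙_ → StronglyErgodic _∙_)
mainTheorem2 zero _∙_ up =
  (λ _ → 1 , s≤s z≤n , λ ()) , (λ _ → 1 , s≤s z≤n , λ _ _ _ _ ()) ,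
  strongly-ergodic⇔K≐H up , quasigroup⇒strongly-ergodic up
  where open Uniform
mainTheorem2 (suc n) _∙_ up =
  strongly-ergodic⇒ergodic up zero , strongly-ergodic⇒uniform up zero ,
  strongly-ergodic⇔K≐H up , quasigroup⇒strongly-ergodic up
  where open Uniform
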